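{- For every pseudo-linear set $X\subseteq\mathbb{Z}^n$ and every linearization $L$ of $X$, $\dim(X)=\dim(L)$.
   Context: A monoid of $\mathbb{Q}^n$ is a set $M$ with $\vec{0}\in M$ and $M+M\subseteq M$; $P^*$ is the monoid generated by $P$; finitely generated means $M=P^*$ with $P$ finite. $\vec{a}\in M$ is interior to $M$ if for every $\vec{x}\in M$ there is an integer $N\geq1$ with $N\vec{a}\in\vec{x}+M$. $X\subseteq\mathbb{Z}^n$ is pseudo-linear if there are $\vec{b}\in\mathbb{Z}^n$ and a finitely generated monoid $M\subseteq\mathbb{Z}^n$ with $X\subseteq\vec{b}+M$ such that for every finite set $R$ of interior vectors of $M$ there is $\vec{x}\in X$ with $\vec{x}+R^*\subseteq X$; then $\vec{b}+M$ is called a linearization of $X$. The rank of a $\mathbb{Q}$-vector space is the minimal size of a generating set. The dimension $\dim(Y)$ of a nonempty $Y\subseteq\mathbb{Q}^n$ is the minimal $d\in\{0,\ldots,n\}$ such that $Y\subseteq\bigcup_{j=1}^k(\vec{a}_j+V_j)$ for some $k\in\mathbb{N}$, $\vec{a}_j\in\mathbb{Q}^n$ and vector spaces $V_j$ of rank at most $d$; $\dim(\emptyset)=-\infty$. -}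

module Defs where

open import Data.Nat as ℕ using (ℕ; zero; suc)
open import Data.Integer as ℤ using (ℤ; +_)
open import Data.Rational as ℚ using (ℚ)
open import Data.Fin as F using (Fin)
open import Data.Maybe using (Maybe; just; nothing)
open import Data.Product using (Σ; ∃; _×_; _,_)
open import Data.Empty using (⊥)
open import Relation.Nullary using (¬_)
open import Relation.Binary.PropositionalEquality using (_≡_)

ℤ^ : ℕ → Set
ℤ^ n = Fin n → ℤ

ℚ^ : ℕ → Set
ℚ^ n = Fin n → ℚ

Subset : ℕ → Set₁
Subset n = ℤ^ n → Set

sumℤ : ∀ {k} → (Fin k → ℤ) → ℤ
sumℤ {zero} f = + 0
sumℤ {suc k} f = f F.zero ℤ.+ sumℤ (λ i → f (F.suc i))

sumℚ : ∀ {k} → (Fin k → ℚ) → ℚ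
sumℚ {zero} f = ℚ.0ℚ
sumℚ {suc k} f = f F.zero ℚ.+ sumℚ (λ i → f (F.suc i))

_+ᵥ_ : ∀ {n} → ℤ^ n → ℤ^ n → ℤ^ n
(x +ᵥ y) i = x i ℤ.+ y i

_·ᵥ_ : ∀ {n} → ℕ → ℤ^ n → ℤ^ n
(N ·ᵥ x) i = (+ N) ℤ.* x i

toℚ^ : ∀ {n} → ℤ^ n → ℚ^ n
toℚ^ x i = x i ℚ./ 1

_* : ∀ {n p} → (Fin p → ℤ^ n) → Subset n
_* {n} {p} P x = Σ (Fin p → ℕ) λ m → ∀ k → x k ≡ sumℤ (λ i → (+ m i) ℤ.* P i k)

Interior : ∀ {n} → Subset n → ℤ^ n → Set
Interior M a = M a × (∀ x → M x → Σ ℕ λ N → (1 ℕ.≤ N) × Σ (ℤ^ _) λ y → M y × (∀ k → (N ·ᵥ a) k ≡ (x +ᵥ y) k))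

_⊕_ : ∀ {n} → ℤ^ n → Subset n → Subset n
(b ⊕ M) x = Σ (ℤ^ _) λ m → M m × (∀ k → x k ≡ (b +ᵥ m) k)

IsLinearization : ∀ {n p} → Subset n → ℤ^ n → (Fin p → ℤ^ n) → Set
IsLinearization {n} X b P =
  (∀ x → X x → (b ⊕ (P *)) x) ×
  (∀ (r : ℕ) (R : Fin r → ℤ^ n) → (∀ i → Interior (P *) (R i)) →
     Σ (ℤ^ n) λ x → X x × (∀ z → (R *) z → X (x +ᵥ z)))

PseudoLinear : ∀ {n} → Subset n → Set
PseudoLinear {n} X = Σ (ℤ^ n) λ b → Σ ℕ λ p → Σ (Fin p → ℤ^ n) λ P → IsLinearization X b P

-- Y (viewed in ℚⁿ) is covered by finitely many affine spaces a_j + V_j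
-- with V_j a vector space of rank at most d (i.e. spanned by d vectors)
Coverable : ∀ {n} → Subset n → ℕ → Set
Coverable {n} Y d =
  Σ ℕ λ k → Σ (Fin k → ℚ^ n) λ a → Σ (Fin k → Fin d → ℚ^ n) λ v →
    ∀ y → Y y → Σ (Fin k) λ j → Σ (Fin d → ℚ) λ c →
      ∀ i → toℚ^ y i ≡ a j i ℚ.+ sumℚ (λ l → c l ℚ.* v j l i)

-- IsDim Y e : dim(Y) = e, where nothing encodes -∞
IsDim : ∀ {n} → Subset n → Maybe ℕ → Set
IsDim Y nothing = ∀ y → ¬ Y y
IsDim {n} Y (just d) =
  (d ℕ.≤ n) × (Σ (ℤ^ n) Y) × Coverable Y d × (∀ d′ → d′ ℕ.< d → ¬ Coverable Y d′)

module Submission where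

-- Since X ⊆ L, every finite cover of L by affine spaces covers X and L is
-- nonempty whenever X is; X is nonempty by the linearization property with
-- no interior vectors.  The real content is the converse: a cover of X by k
-- affine spaces a_j + V_j yields a cover of L by the k translates
-- (b - x₀ + a_j) + V_j.  Let g be the sum of the generators of P* (an
-- interior vector) and R = {g} ∪ {g + P_i}, a finite set of interior
-- vectors; the linearization gives x₀ ∈ X with x₀ + R* ⊆ X.  For y = b + w
-- with w ∈ P*, the points x₀ + w + N·g for N = |w|, …, |w| + k all lie in
-- x₀ + R* ⊆ X, so by pigeonhole two of them lie in one a_j + V_j.  An
-- affine space containing two points of a line contains the whole line,
-- in particular x₀ + w, hence y ∈ (b - x₀ + a_j) + V_j.

open import Defs
open import Data.Nat as ℕ using (ℕ; zero; suc)
import Data.Nat.Properties as ℕP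
open import Data.Integer as ℤ using (ℤ; +_)
import Data.Integer.Properties as ℤP
open import Data.Rational as ℚ using (ℚ; 0ℚ; 1ℚ)
import Data.Rational.Properties as ℚP
import Data.Rational.Unnormalised as ℚᵘ
import Data.Rational.Unnormalised.Properties as ℚᵘP
open import Data.Rational.Solver using (module +-*-Solver)
open import Data.Fin as F using (Fin)
import Data.Fin.Properties as FP
open import Data.Vec.Functional using (_∷_)
open import Data.Maybe using (Maybe; just; nothing)
open import Data.Product using (Σ; _×_; _,_; proj₁; proj₂)
open import Function using (_∘_)
open import Algebra.Properties.CommutativeSemigroup ℤP.+-commutativeSemigroup
  using (interchange)
open import Relation.Binary.PropositionalEquality

sumℕ : ∀ {k} → (Fin k → ℕ) → ℕ
sumℕ {zero} m = 0
sumℕ {suc k} m = m F.zero ℕ.+ sumℕ (m ∘ F.suc)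

sumℕ-≥ : ∀ {k} (m : Fin k → ℕ) i → m i ℕ.≤ sumℕ m
sumℕ-≥ m F.zero = ℕP.m≤m+n _ _
sumℕ-≥ m (F.suc i) = ℕP.≤-trans (sumℕ-≥ (m ∘ F.suc) i) (ℕP.m≤n+m _ (m F.zero))

sumℤ-cong : ∀ {k} {f g : Fin k → ℤ} → (∀ i → f i ≡ g i) → sumℤ f ≡ sumℤ g
sumℤ-cong {zero} f≡g = refl
sumℤ-cong {suc k} f≡g = cong₂ ℤ._+_ (f≡g F.zero) (sumℤ-cong (f≡g ∘ F.suc))

sumℤ-+ : ∀ {k} (f g : Fin k → ℤ) → sumℤ (λ i → f i ℤ.+ g i) ≡ sumℤ f ℤ.+ sumℤ g
sumℤ-+ {zero} f g = refl
sumℤ-+ {suc k} f g =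
  trans (cong (ℤ._+_ (f F.zero ℤ.+ g F.zero)) (sumℤ-+ (f ∘ F.suc) (g ∘ F.suc)))
        (interchange (f F.zero) (g F.zero) (sumℤ (f ∘ F.suc)) (sumℤ (g ∘ F.suc)))

sumℤ-*ˡ : ∀ {k} (c : ℤ) (f : Fin k → ℤ) → sumℤ (λ i → c ℤ.* f i) ≡ c ℤ.* sumℤ f
sumℤ-*ˡ {zero} c f = sym (ℤP.*-zeroʳ c)
sumℤ-*ˡ {suc k} c f =
  trans (cong (ℤ._+_ (c ℤ.* f F.zero)) (sumℤ-*ˡ c (f ∘ F.suc)))
        (sym (ℤP.*-distribˡ-+ c (f F.zero) (sumℤ (f ∘ F.suc))))

sumℤ-*ʳ : ∀ {k} (f : Fin k → ℤ) (c : ℤ) → sumℤ (λ i → f i ℤ.* c) ≡ sumℤ f ℤ.* c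
sumℤ-*ʳ {zero} f c = refl
sumℤ-*ʳ {suc k} f c =
  trans (cong (ℤ._+_ (f F.zero ℤ.* c)) (sumℤ-*ʳ (f ∘ F.suc) c))
        (sym (ℤP.*-distribʳ-+ c (f F.zero) (sumℤ (f ∘ F.suc))))

sumℤ-pos : ∀ {k} (m : Fin k → ℕ) → sumℤ (λ i → + m i) ≡ + sumℕ m
sumℤ-pos {zero} m = refl
sumℤ-pos {suc k} m =
  trans (cong (ℤ._+_ (+ m F.zero)) (sumℤ-pos (m ∘ F.suc))) (sym (ℤP.pos-+ (m F.zero) (sumℕ (m ∘ F.suc))))

lin : ∀ {n p} → (Fin p → ℤ^ n) → (Fin p → ℕ) → ℤ^ n
lin P m k = sumℤ (λ i → + m i ℤ.* P i k)

unit : ∀ {p} → Fin p → Fin p → ℕ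
unit F.zero F.zero = 1
unit F.zero (F.suc _) = 0
unit (F.suc _) F.zero = 0
unit (F.suc i) (F.suc l) = unit i l

sumℤ-zero : ∀ k → sumℤ {k} (λ _ → + 0) ≡ + 0
sumℤ-zero zero = refl
sumℤ-zero (suc k) = trans (ℤP.+-identityˡ _) (sumℤ-zero k)

lin-unit : ∀ {n p} (P : Fin p → ℤ^ n) i k → lin P (unit i) k ≡ P i k
lin-unit {p = suc p} P F.zero k =
  trans (cong₂ ℤ._+_ (ℤP.*-identityˡ (P F.zero k)) (sumℤ-zero p)) (ℤP.+-identityʳ (P F.zero k))
lin-unit P (F.suc i) k = trans (ℤP.+-identityˡ _) (lin-unit (P ∘ F.suc) i k)

module Monoid {n p : ℕ} (P : Fin p → ℤ^ n) where

  lin-cong : ∀ {m m′} → (∀ i → m i ≡ m′ i) → ∀ k → lin P m k ≡ lin P m′ k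
  lin-cong m≡m′ k = sumℤ-cong (λ i → cong (λ c → + c ℤ.* P i k) (m≡m′ i))

  lin-+ : ∀ m₁ m₂ k → lin P (λ i → m₁ i ℕ.+ m₂ i) k ≡ lin P m₁ k ℤ.+ lin P m₂ k
  lin-+ m₁ m₂ k =
    trans (sumℤ-cong (λ i → trans (cong (ℤ._* P i k) (ℤP.pos-+ (m₁ i) (m₂ i)))
                                  (ℤP.*-distribʳ-+ (P i k) (+ m₁ i) (+ m₂ i))))
          (sumℤ-+ (λ i → + m₁ i ℤ.* P i k) (λ i → + m₂ i ℤ.* P i k))

  lin-scale : ∀ N m k → lin P (λ i → N ℕ.* m i) k ≡ + N ℤ.* lin P m k
  lin-scale N m k =
    trans (sumℤ-cong (λ i → trans (cong (ℤ._* P i k) (ℤP.pos-* N (m i)))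
                                  (ℤP.*-assoc (+ N) (+ m i) (P i k))))
          (sumℤ-*ˡ (+ N) (λ i → + m i ℤ.* P i k))

  generator-∈ : ∀ i → (P *) (P i)
  generator-∈ i = unit i , λ k → sym (lin-unit P i k)

  +-closed : ∀ {u w} → (P *) u → (P *) w → (P *) (u +ᵥ w)
  +-closed (m₁ , u≡) (m₂ , w≡) =
    (λ i → m₁ i ℕ.+ m₂ i) , λ k → trans (cong₂ ℤ._+_ (u≡ k) (w≡ k)) (sym (lin-+ m₁ m₂ k))

  scale-closed : ∀ N {u} → (P *) u → (P *) (N ·ᵥ u)
  scale-closed N (m , u≡) =
    (λ i → N ℕ.* m i) , λ k → trans (cong (+ N ℤ.*_) (u≡ k)) (sym (lin-scale N m k))

  g : ℤ^ n
  g = lin P (λ _ → 1)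

  -- g is interior: for x = Σ mᵢ·Pᵢ and N = 1 + Σ mᵢ we have
  -- N·g = x + Σ (N - mᵢ)·Pᵢ.
  g-interior : Interior (P *) g
  g-interior = ((λ _ → 1) , λ k → refl) , λ x → λ (m , x≡) →
    let N = suc (sumℕ m)
        rest = λ i → N ℕ.∸ m i
        N≡m+rest : ∀ i → N ℕ.* 1 ≡ m i ℕ.+ rest i
        N≡m+rest i = trans (ℕP.*-identityʳ N)
                           (sym (ℕP.m+[n∸m]≡n (ℕP.≤-trans (sumℕ-≥ m i) (ℕP.n≤1+n _))))
    in N , ℕ.s≤s ℕ.z≤n , lin P rest , (rest , λ k → refl) , λ k → begin
         + N ℤ.* g k                       ≡⟨ lin-scale N (λ _ → 1) k ⟨
         lin P (λ _ → N ℕ.* 1) k           ≡⟨ lin-cong N≡m+rest k ⟩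
         lin P (λ i → m i ℕ.+ rest i) k    ≡⟨ lin-+ m rest k ⟩
         lin P m k ℤ.+ lin P rest k        ≡⟨ cong (ℤ._+ lin P rest k) (x≡ k) ⟨
         x k ℤ.+ lin P rest k              ∎
    where open ≡-Reasoning

  interior-+ : ∀ {u w} → Interior (P *) u → (P *) w → Interior (P *) (u +ᵥ w)
  interior-+ {u} {w} (u∈ , u-absorbs) w∈ = +-closed u∈ w∈ , λ x x∈ →
    let (N , N≥1 , y , y∈ , Nu≡x+y) = u-absorbs x x∈ in
    N , N≥1 , y +ᵥ (N ·ᵥ w) , +-closed y∈ (scale-closed N w∈) , λ k →
      trans (ℤP.*-distribˡ-+ (+ N) (u k) (w k))
            (trans (cong (ℤ._+ (+ N ℤ.* w k)) (Nu≡x+y k)) (ℤP.+-assoc (x k) (y k) (+ N ℤ.* w k)))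

  -- R = {g} ∪ {g + Pᵢ}: finitely many interior vectors whose monoid R*
  -- contains, for each w = Σ mᵢ·Pᵢ ∈ P*, the ray w + N·g for N ≥ Σ mᵢ.
  directions : Fin (suc p) → ℤ^ n
  directions = g ∷ (λ i → g +ᵥ P i)

  directions-interior : ∀ i → Interior (P *) (directions i)
  directions-interior F.zero = g-interior
  directions-interior (F.suc i) = interior-+ g-interior (generator-∈ i)

  ray-∈ : ∀ {w} m → (∀ k → w k ≡ lin P m k) → ∀ t →
          (directions *) (((t ℕ.+ sumℕ m) ·ᵥ g) +ᵥ w)
  ray-∈ {w} m w≡ t = t ∷ m , λ k → begin
      + (t ℕ.+ M) ℤ.* g k ℤ.+ w k
        ≡⟨ cong₂ ℤ._+_ (trans (cong (ℤ._* g k) (ℤP.pos-+ t M)) (ℤP.*-distribʳ-+ (g k) (+ t) (+ M)))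
                       (w≡ k) ⟩
      + t ℤ.* g k ℤ.+ + M ℤ.* g k ℤ.+ lin P m k
        ≡⟨ ℤP.+-assoc (+ t ℤ.* g k) (+ M ℤ.* g k) (lin P m k) ⟩
      + t ℤ.* g k ℤ.+ (+ M ℤ.* g k ℤ.+ lin P m k)
        ≡⟨ cong (ℤ._+_ (+ t ℤ.* g k)) (shifted-sum k) ⟨
      + t ℤ.* g k ℤ.+ sumℤ (λ l → + m l ℤ.* (g k ℤ.+ P l k)) ∎
    where
    open ≡-Reasoning
    M : ℕ
    M = sumℕ m
    shifted-sum : ∀ k → sumℤ (λ l → + m l ℤ.* (g k ℤ.+ P l k)) ≡ + M ℤ.* g k ℤ.+ lin P m k
    shifted-sum k =
      trans (sumℤ-cong (λ l → ℤP.*-distribˡ-+ (+ m l) (g k) (P l k)))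
      (trans (sumℤ-+ (λ l → + m l ℤ.* g k) (λ l → + m l ℤ.* P l k))
             (cong (ℤ._+ lin P m k) (trans (sumℤ-*ʳ (λ l → + m l) (g k))
                                           (cong (ℤ._* g k) (sumℤ-pos m)))))

φ : ℤ → ℚ
φ z = z ℚ./ 1

φ-unnormalised : ∀ z → ℚ.toℚᵘ (φ z) ℚᵘ.≃ ℚᵘ.mkℚᵘ z 0
φ-unnormalised z = ℚP.toℚᵘ-fromℚᵘ (ℚᵘ.mkℚᵘ z 0)

φ-+ : ∀ a b → φ (a ℤ.+ b) ≡ φ a ℚ.+ φ b
φ-+ a b = ℚP.toℚᵘ-injective (ℚᵘP.≃-trans (φ-unnormalised (a ℤ.+ b)) (ℚᵘP.≃-trans integral-sum
  (ℚᵘP.≃-sym (ℚᵘP.≃-trans (ℚP.toℚᵘ-homo-+ (φ a) (φ b))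
                          (ℚᵘP.+-cong (φ-unnormalised a) (φ-unnormalised b))))))
  where
  integral-sum : ℚᵘ.mkℚᵘ (a ℤ.+ b) 0 ℚᵘ.≃ ℚᵘ.mkℚᵘ a 0 ℚᵘ.+ ℚᵘ.mkℚᵘ b 0
  integral-sum = ℚᵘ.*≡* (cong (ℤ._* + 1) (cong₂ ℤ._+_ (sym (ℤP.*-identityʳ a)) (sym (ℤP.*-identityʳ b))))

φ-* : ∀ a b → φ (a ℤ.* b) ≡ φ a ℚ.* φ b
φ-* a b = ℚP.toℚᵘ-injective (ℚᵘP.≃-trans (φ-unnormalised (a ℤ.* b)) (ℚᵘP.≃-trans (ℚᵘ.*≡* refl)
  (ℚᵘP.≃-sym (ℚᵘP.≃-trans (ℚP.toℚᵘ-homo-* (φ a) (φ b))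
                          (ℚᵘP.*-cong (φ-unnormalised a) (φ-unnormalised b))))))

φ-injective : ∀ {a b} → φ a ≡ φ b → a ≡ b
φ-injective {a} {b} φa≡φb
  with ℚᵘP.≃-trans (ℚᵘP.≃-sym (φ-unnormalised a))
                   (ℚᵘP.≃-trans (ℚP.toℚᵘ-cong φa≡φb) (φ-unnormalised b))
... | ℚᵘ.*≡* a1≡b1 = trans (sym (ℤP.*-identityʳ a)) (trans a1≡b1 (ℤP.*-identityʳ b))

InAffine : ∀ {n d} → ℚ^ n → (Fin d → ℚ^ n) → ℚ^ n → Set
InAffine {d = d} a v y = Σ (Fin d → ℚ) λ c → ∀ i → y i ≡ a i ℚ.+ sumℚ (λ l → c l ℚ.* v l i)

InAffine-resp : ∀ {n d} {a : ℚ^ n} {v : Fin d → ℚ^ n} {y z : ℚ^ n} →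
                (∀ i → y i ≡ z i) → InAffine a v y → InAffine a v z
InAffine-resp y≡z (c , y≡) = c , λ i → trans (sym (y≡z i)) (y≡ i)

InAffine-translate : ∀ {n d} {a : ℚ^ n} {v : Fin d → ℚ^ n} {y : ℚ^ n} (t : ℚ^ n) →
                     InAffine a v y → InAffine (λ i → t i ℚ.+ a i) v (λ i → t i ℚ.+ y i)
InAffine-translate t (c , y≡) = c , λ i → trans (cong (t i ℚ.+_) (y≡ i)) (sym (ℚP.+-assoc (t i) _ _))

sumℚ-linear : ∀ {d} (α β : ℚ) (f g h : Fin d → ℚ) →
  sumℚ (λ l → (α ℚ.* f l ℚ.+ β ℚ.* g l) ℚ.* h l)
    ≡ α ℚ.* sumℚ (λ l → f l ℚ.* h l) ℚ.+ β ℚ.* sumℚ (λ l → g l ℚ.* h l)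
sumℚ-linear {zero} α β f g h =
  solve 2 (λ α β → con 0ℚ := α :* con 0ℚ :+ β :* con 0ℚ) refl α β
  where open +-*-Solver
sumℚ-linear {suc d} α β f g h =
  trans (cong (ℚ._+_ ((α ℚ.* f F.zero ℚ.+ β ℚ.* g F.zero) ℚ.* h F.zero))
              (sumℚ-linear α β (f ∘ F.suc) (g ∘ F.suc) (h ∘ F.suc)))
        (solve 7 (λ α β f g h S T → (α :* f :+ β :* g) :* h :+ (α :* S :+ β :* T)
                                    := α :* (f :* h :+ S) :+ β :* (g :* h :+ T)) refl
           α β (f F.zero) (g F.zero) (h F.zero)
           (sumℚ (λ l → f (F.suc l) ℚ.* h (F.suc l))) (sumℚ (λ l → g (F.suc l) ℚ.* h (F.suc l))))
  where open +-*-Solver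

affine-combination : ∀ {n d} {a : ℚ^ n} {v : Fin d → ℚ^ n} {y₁ y₂ : ℚ^ n} (μ : ℚ) →
  InAffine a v y₁ → InAffine a v y₂ → InAffine a v (λ i → (1ℚ ℚ.- μ) ℚ.* y₁ i ℚ.+ μ ℚ.* y₂ i)
affine-combination {a = a} {v} {y₁} {y₂} μ (c₁ , y₁≡) (c₂ , y₂≡) =
  (λ l → (1ℚ ℚ.- μ) ℚ.* c₁ l ℚ.+ μ ℚ.* c₂ l) , λ i → begin
    (1ℚ ℚ.- μ) ℚ.* y₁ i ℚ.+ μ ℚ.* y₂ i
      ≡⟨ cong₂ (λ p q → (1ℚ ℚ.- μ) ℚ.* p ℚ.+ μ ℚ.* q) (y₁≡ i) (y₂≡ i) ⟩
    (1ℚ ℚ.- μ) ℚ.* (a i ℚ.+ S₁ i) ℚ.+ μ ℚ.* (a i ℚ.+ S₂ i)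
      ≡⟨ solve 4 (λ μ a S₁ S₂ → (con 1ℚ :- μ) :* (a :+ S₁) :+ μ :* (a :+ S₂)
                                := a :+ ((con 1ℚ :- μ) :* S₁ :+ μ :* S₂)) refl μ (a i) (S₁ i) (S₂ i) ⟩
    a i ℚ.+ ((1ℚ ℚ.- μ) ℚ.* S₁ i ℚ.+ μ ℚ.* S₂ i)
      ≡⟨ cong (a i ℚ.+_) (sumℚ-linear (1ℚ ℚ.- μ) μ c₁ c₂ (λ l → v l i)) ⟨
    a i ℚ.+ sumℚ (λ l → ((1ℚ ℚ.- μ) ℚ.* c₁ l ℚ.+ μ ℚ.* c₂ l) ℚ.* v l i) ∎
  where
  open ≡-Reasoning
  open +-*-Solver
  S₁ S₂ : ℚ^ _
  S₁ i = sumℚ (λ l → c₁ l ℚ.* v l i)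
  S₂ i = sumℚ (λ l → c₂ l ℚ.* v l i)

line : ∀ {n} → ℚ^ n → ℚ^ n → ℚ → ℚ^ n
line q u s i = q i ℚ.+ s ℚ.* u i

-- An affine space containing two distinct points of a line contains the
-- whole line: line(s) = (1 - μ)·line(s₁) + μ·line(s₂) for μ = (s - s₁)/(s₂ - s₁).
line-in-affine : ∀ {n d} {a : ℚ^ n} {v : Fin d → ℚ^ n} {q u : ℚ^ n} {s₁ s₂ : ℚ} → s₂ ≢ s₁ →
  InAffine a v (line q u s₁) → InAffine a v (line q u s₂) → ∀ s → InAffine a v (line q u s)
line-in-affine {a = a} {v} {q} {u} {s₁} {s₂} s₂≢s₁ on₁ on₂ s =
  InAffine-resp {a = a} {v} combination≡line (affine-combination {a = a} {v} μ on₁ on₂)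
  where
  open +-*-Solver
  inverse = ℚP.#⇒invertible s₂≢s₁
  μ = (s ℚ.- s₁) ℚ.* proj₁ inverse

  μ-scaled : μ ℚ.* (s₂ ℚ.- s₁) ≡ s ℚ.- s₁
  μ-scaled = trans (ℚP.*-assoc (s ℚ.- s₁) (proj₁ inverse) (s₂ ℚ.- s₁))
                   (trans (cong ((s ℚ.- s₁) ℚ.*_) (proj₁ (proj₂ inverse))) (ℚP.*-identityʳ (s ℚ.- s₁)))

  combination≡line : ∀ i → (1ℚ ℚ.- μ) ℚ.* line q u s₁ i ℚ.+ μ ℚ.* line q u s₂ i ≡ line q u s i
  combination≡line i = begin
    (1ℚ ℚ.- μ) ℚ.* (q i ℚ.+ s₁ ℚ.* u i) ℚ.+ μ ℚ.* (q i ℚ.+ s₂ ℚ.* u i)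
      ≡⟨ solve 5 (λ μ q u s₁ s₂ → (con 1ℚ :- μ) :* (q :+ s₁ :* u) :+ μ :* (q :+ s₂ :* u)
                                  := q :+ s₁ :* u :+ (μ :* (s₂ :- s₁)) :* u) refl μ (q i) (u i) s₁ s₂ ⟩
    q i ℚ.+ s₁ ℚ.* u i ℚ.+ (μ ℚ.* (s₂ ℚ.- s₁)) ℚ.* u i
      ≡⟨ cong (λ r → q i ℚ.+ s₁ ℚ.* u i ℚ.+ r ℚ.* u i) μ-scaled ⟩
    q i ℚ.+ s₁ ℚ.* u i ℚ.+ (s ℚ.- s₁) ℚ.* u i
      ≡⟨ solve 4 (λ q u s₁ s → q :+ s₁ :* u :+ (s :- s₁) :* u := q :+ s :* u) refl (q i) (u i) s₁ s ⟩
    q i ℚ.+ s ℚ.* u i ∎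
    where open ≡-Reasoning

ray-on-line : ∀ {n} (x g w : ℤ^ n) (N : ℕ) i →
  toℚ^ (x +ᵥ ((N ·ᵥ g) +ᵥ w)) i ≡ line (toℚ^ (x +ᵥ w)) (toℚ^ g) (φ (+ N)) i
ray-on-line x g w N i = begin
  φ (x i ℤ.+ (+ N ℤ.* g i ℤ.+ w i))
    ≡⟨ trans (φ-+ (x i) _) (cong (φ (x i) ℚ.+_) (trans (φ-+ (+ N ℤ.* g i) (w i))
                                                       (cong (ℚ._+ φ (w i)) (φ-* (+ N) (g i))))) ⟩
  φ (x i) ℚ.+ (φ (+ N) ℚ.* φ (g i) ℚ.+ φ (w i))
    ≡⟨ solve 4 (λ x N g w → x :+ (N :* g :+ w) := (x :+ w) :+ N :* g) refl (φ (x i)) (φ (+ N)) (φ (g i)) (φ (w i)) ⟩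
  (φ (x i) ℚ.+ φ (w i)) ℚ.+ φ (+ N) ℚ.* φ (g i)
    ≡⟨ cong (ℚ._+ φ (+ N) ℚ.* φ (g i)) (φ-+ (x i) (w i)) ⟨
  φ (x i ℤ.+ w i) ℚ.+ φ (+ N) ℚ.* φ (g i) ∎
  where
  open ≡-Reasoning
  open +-*-Solver

Coverable-mono : ∀ {n d} {Y Z : Subset n} → (∀ y → Y y → Z y) → Coverable Z d → Coverable Y d
Coverable-mono Y⊆Z (k , a , v , cover) = k , a , v , λ y y∈ → cover y (Y⊆Z y y∈)

Coverable-lift : ∀ {n p d} {X : Subset n} {b : ℤ^ n} {P : Fin p → ℤ^ n} →
  IsLinearization X b P → Coverable X d → Coverable (b ⊕ (P *)) d
Coverable-lift {n} {p} {X = X} {b} {P} (_ , linearized) (k , a , v , cover) =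
  k , (λ j i → shift i ℚ.+ a j i) , v , coverL
  where
  open Monoid P
  x₀ : ℤ^ n
  x₀ = proj₁ (linearized (suc p) directions directions-interior)
  x₀+R*⊆X : ∀ z → (directions *) z → X (x₀ +ᵥ z)
  x₀+R*⊆X = proj₂ (proj₂ (linearized (suc p) directions directions-interior))
  shift : ℚ^ n
  shift i = φ (b i) ℚ.- φ (x₀ i)

  coverL : ∀ y → (b ⊕ (P *)) y → Σ (Fin k) λ j → InAffine (λ i → shift i ℚ.+ a j i) (v j) (toℚ^ y)
  coverL y (w , (m , w≡) , y≡) =
    j , InAffine-resp {a = λ i → shift i ℚ.+ a j i} {v j} y-as-translate
                      (InAffine-translate shift x₀+w-in-j)
    where
    M : ℕ
    M = sumℕ m
    q u : ℚ^ n
    q = toℚ^ (x₀ +ᵥ w)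
    u = toℚ^ g
    -- the k + 1 ray points x₀ + w + (t + M)·g, t ≤ k, lie in X, hence in
    -- the k pieces of the cover
    piece : (t : Fin (suc k)) → Σ (Fin k) λ j′ →
            InAffine (a j′) (v j′) (toℚ^ (x₀ +ᵥ (((F.toℕ t ℕ.+ M) ·ᵥ g) +ᵥ w)))
    piece t = cover _ (x₀+R*⊆X _ (ray-∈ m w≡ (F.toℕ t)))
    collision : Σ (Fin (suc k)) λ t₁ → Σ (Fin (suc k)) λ t₂ →
                t₁ F.< t₂ × proj₁ (piece t₁) ≡ proj₁ (piece t₂)
    collision = FP.pigeonhole (ℕP.n<1+n k) (proj₁ ∘ piece)
    t₁ t₂ : Fin (suc k)
    t₁ = proj₁ collision
    t₂ = proj₁ (proj₂ collision)
    j : Fin k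
    j = proj₁ (piece t₁)

    on-line : ∀ t → InAffine (a (proj₁ (piece t))) (v (proj₁ (piece t))) (line q u (φ (+ (F.toℕ t ℕ.+ M))))
    on-line t = InAffine-resp {a = a (proj₁ (piece t))} {v (proj₁ (piece t))}
                              (ray-on-line x₀ g w (F.toℕ t ℕ.+ M)) (proj₂ (piece t))

    parameters-distinct : φ (+ (F.toℕ t₂ ℕ.+ M)) ≢ φ (+ (F.toℕ t₁ ℕ.+ M))
    parameters-distinct same = ℕP.<⇒≢ (proj₁ (proj₂ (proj₂ collision)))
      (sym (ℕP.+-cancelʳ-≡ M _ _ (ℤP.+-injective (φ-injective same))))

    x₀+w-in-j : InAffine (a j) (v j) (line q u 0ℚ)
    x₀+w-in-j = line-in-affine {a = a j} {v j} {q} {u} parameters-distinct (on-line t₁)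
      (subst (λ j′ → InAffine (a j′) (v j′) (line q u (φ (+ (F.toℕ t₂ ℕ.+ M)))))
             (sym (proj₂ (proj₂ (proj₂ collision)))) (on-line t₂)) 0ℚ

    y-as-translate : ∀ i → shift i ℚ.+ line q u 0ℚ i ≡ toℚ^ y i
    y-as-translate i = begin
      (φ (b i) ℚ.- φ (x₀ i)) ℚ.+ (φ (x₀ i ℤ.+ w i) ℚ.+ 0ℚ ℚ.* u i)
        ≡⟨ cong (λ r → (φ (b i) ℚ.- φ (x₀ i)) ℚ.+ (r ℚ.+ 0ℚ ℚ.* u i)) (φ-+ (x₀ i) (w i)) ⟩
      (φ (b i) ℚ.- φ (x₀ i)) ℚ.+ ((φ (x₀ i) ℚ.+ φ (w i)) ℚ.+ 0ℚ ℚ.* u i)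
        ≡⟨ solve 4 (λ b x w u → (b :- x) :+ ((x :+ w) :+ con 0ℚ :* u) := b :+ w) refl
                 (φ (b i)) (φ (x₀ i)) (φ (w i)) (u i) ⟩
      φ (b i) ℚ.+ φ (w i)
        ≡⟨ φ-+ (b i) (w i) ⟨
      φ (b i ℤ.+ w i)
        ≡⟨ cong φ (y≡ i) ⟨
      φ (y i) ∎
      where
      open ≡-Reasoning
      open +-*-Solver

IsDim-transfer : ∀ {n} {Y Z : Subset n} →
  (Σ (ℤ^ n) Z → Σ (ℤ^ n) Y) → (Σ (ℤ^ n) Y → Σ (ℤ^ n) Z) →
  (∀ d → Coverable Y d → Coverable Z d) → (∀ d → Coverable Z d → Coverable Y d) →
  ∀ e → IsDim Y e → IsDim Z e
IsDim-transfer Z→Y _ _ _ nothing Y-empty z z∈ = Y-empty (proj₁ (Z→Y (z , z∈))) (proj₂ (Z→Y (z , z∈)))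
IsDim-transfer _ Y→Z Y⇒Z Z⇒Y (just d) (d≤n , inhabited , coverable , minimal) =
  d≤n , Y→Z inhabited , Y⇒Z d coverable , λ d′ d′<d cover → minimal d′ d′<d (Z⇒Y d′ cover)

lemma7p5 : ∀ {n p} (X : Subset n) → PseudoLinear X →
           (b : ℤ^ n) (P : Fin p → ℤ^ n) → IsLinearization X b P →
           ∀ (e : Maybe ℕ) → (IsDim X e → IsDim (b ⊕ (P *)) e) × (IsDim (b ⊕ (P *)) e → IsDim X e)
lemma7p5 X _ b P hL e =
  IsDim-transfer L→X X→L lift restrict e , IsDim-transfer X→L L→X restrict lift e
  where
  X⊆L : ∀ x → X x → (b ⊕ (P *)) x
  X⊆L = proj₁ hL
  -- X is nonempty: apply the linearization property to the empty set R.
  L→X : Σ _ (b ⊕ (P *)) → Σ _ X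
  L→X _ = let (x , x∈ , _) = proj₂ hL 0 (λ ()) (λ ()) in x , x∈
  X→L : Σ _ X → Σ _ (b ⊕ (P *))
  X→L (x , x∈) = x , X⊆L x x∈
  lift : ∀ d → Coverable X d → Coverable (b ⊕ (P *)) d
  lift d = Coverable-lift {d = d} {b = b} {P} hL
  restrict : ∀ d → Coverable (b ⊕ (P *)) d → Coverable X d
  restrict d = Coverable-mono {d = d} X⊆L
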